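{- Let $p$ be a prime, $m>1$ an integer, and $n=p^m$. Then the Wiener index and the hyper-Wiener index of the essential ideal graph $\mathcal{E}_{\mathbb{Z}_n}$ are both equal to $\binom{m-1}{2}$.
   Context: $\mathbb{Z}_n$ is the ring of integers modulo $n$. An ideal $I$ of a commutative ring $R$ is essential if $I\cap J\neq\{0\}$ for every nonzero ideal $J$ of $R$. The essential ideal graph $\mathcal{E}_{\mathbb{Z}_n}$ is the simple graph whose vertex set is the set of all nonzero proper ideals of $\mathbb{Z}_n$, two distinct vertices $I,K$ being adjacent if and only if $I+K$ is an essential ideal of $\mathbb{Z}_n$. For a connected graph $G$ with distance $d$, the Wiener index is $W(G)=\sum_{\{u,v\}} d(u,v)$, summed over unordered pairs of distinct vertices, and the hyper-Wiener index is $WW(G)=\frac12 W(G)+\frac12\sum_{\{u,v\}} d(u,v)^2$, again over unordered pairs of distinct vertices. -}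

module Defs where

open import Data.Bool using (Bool; true; false)
open import Data.Nat using (ℕ; zero; suc; _+_; _*_; _∸_; _^_; _≤_; _<_; NonZero; _%_; _/_)
open import Data.Nat.Properties using (m^n≢0)
open import Data.Nat.DivMod using (m%n<n)
import Data.Nat.Primality
open Data.Nat.Primality using (Prime)
open import Data.Nat.Base using (nonTrivial⇒nonZero)
open import Data.Fin using (Fin; toℕ; fromℕ<)
open import Data.Fin.Subset using (Subset; _∈_; ⁅_⁆; ⊤)
open import Data.Fin.Subset.Properties using (_∈?_)
open import Data.Fin.Properties using (all?)
open import Data.Vec using (Vec; []; _∷_)
open import Data.Vec.Properties using (≡-dec)
import Data.Bool.Properties as BoolP
open import Data.List using (List; []; _∷_; map; _++_; filter)
open import Data.Nat.ListAction using (sum)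
open import Data.Product using (Σ; ∃; ∃-syntax; _×_; _,_)
open import Relation.Binary.PropositionalEquality using (_≡_; _≢_)
open import Relation.Nullary using (Dec; ¬_; ¬?)
open import Relation.Nullary.Decidable using (_×-dec_; _→-dec_)

module ZMod (n : ℕ) {{nz : NonZero n}} where

  R : Set
  R = Fin n

  fromℕ : ℕ → R
  fromℕ a = fromℕ< (m%n<n a n)

  0# : R
  0# = fromℕ 0

  _⊕_ : R → R → R
  a ⊕ b = fromℕ (toℕ a + toℕ b)

  _⊗_ : R → R → R
  a ⊗ b = fromℕ (toℕ a * toℕ b)

  ⊖_ : R → R
  ⊖ a = fromℕ (n ∸ toℕ a)

  IsIdeal : Subset n → Set
  IsIdeal I = (0# ∈ I)
            × (∀ a b → a ∈ I → b ∈ I → (a ⊕ b) ∈ I)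
            × (∀ a → a ∈ I → (⊖ a) ∈ I)
            × (∀ r a → a ∈ I → (r ⊗ a) ∈ I)

  zeroIdeal : Subset n
  zeroIdeal = ⁅ 0# ⁆

  _∈Sum_,_ : R → Subset n → Subset n → Set
  x ∈Sum I , K = ∃[ a ] ∃[ b ] (a ∈ I × b ∈ K × x ≡ a ⊕ b)

  -- I + K is essential: (I + K) ∩ J ≠ {0} for every nonzero ideal J.
  -- Since 0 lies in (I+K) ∩ J, this says (I+K) ∩ J has a nonzero element.
  SumEssential : Subset n → Subset n → Set
  SumEssential I K = ∀ J → IsIdeal J → J ≢ zeroIdeal →
                     ∃[ x ] (x ≢ 0# × x ∈Sum I , K × x ∈ J)

  IsVertex : Subset n → Set
  IsVertex I = IsIdeal I × I ≢ zeroIdeal × I ≢ ⊤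

  Adj : Subset n → Subset n → Set
  Adj I K = I ≢ K × SumEssential I K

  data Walk : Subset n → Subset n → ℕ → Set where
    here : ∀ {u} → Walk u u 0
    step : ∀ {u w v k} → IsVertex w → Adj u w → Walk w v k → Walk u v (suc k)

  IsDist : Subset n → Subset n → ℕ → Set
  IsDist u v k = Walk u v k × (∀ j → Walk u v j → k ≤ j)

  _≟S_ : (I K : Subset n) → Dec (I ≡ K)
  _≟S_ = ≡-dec BoolP._≟_

  isIdeal? : ∀ I → Dec (IsIdeal I)
  isIdeal? I = (0# ∈? I)
    ×-dec all? (λ a → all? (λ b → (a ∈? I) →-dec ((b ∈? I) →-dec ((a ⊕ b) ∈? I))))
    ×-dec all? (λ a → (a ∈? I) →-dec ((⊖ a) ∈? I))
    ×-dec all? (λ r → all? (λ a → (a ∈? I) →-dec ((r ⊗ a) ∈? I)))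

  isVertex? : ∀ I → Dec (IsVertex I)
  isVertex? I = isIdeal? I ×-dec ¬? (I ≟S zeroIdeal) ×-dec ¬? (I ≟S ⊤)

allSubsets : ∀ k → List (Subset k)
allSubsets zero = [] ∷ []
allSubsets (suc k) = map (true ∷_) (allSubsets k) ++ map (false ∷_) (allSubsets k)

pairs : ∀ {A : Set} → List A → List (A × A)
pairs [] = []
pairs (x ∷ xs) = map (x ,_) xs ++ pairs xs

module EssentialGraph (n : ℕ) {{nz : NonZero n}} where
  open ZMod n {{nz}} public

  vertices : List (Subset n)
  vertices = filter isVertex? (allSubsets n)

  wiener : (Subset n → Subset n → ℕ) → ℕ
  wiener d = sum (map (λ { (u , v) → d u v }) (pairs vertices))

  -- hyper-Wiener index: (1/2) W + (1/2) Σ d² = (Σ (d + d²)) / 2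
  hyperWiener : (Subset n → Subset n → ℕ) → ℕ
  hyperWiener d = sum (map (λ { (u , v) → d u v + d u v * d u v }) (pairs vertices)) / 2

primePowNonZero : ∀ p m → Prime p → NonZero (p ^ m)
primePowNonZero p m (Data.Nat.Primality.prime _) = m^n≢0 p m {{nonTrivial⇒nonZero p}}

-- The ideals of ℤ_{p^m} form the chain (p^i), 0 ≤ i ≤ m: an ideal containing x contains
-- gcd(x, p^m) (Bézout), which is p^k for the p-adic valuation k of x, so a nonzero ideal is
-- (p^k) for the least such valuation k. Hence the vertices are (p), …, (p^(m-1)), and every
-- nonzero ideal contains p^(m-1). Since I + K ⊇ I, the sum of two vertices therefore meets
-- every nonzero ideal in p^(m-1) ≠ 0 and is essential: the graph is complete on m - 1
-- vertices, every distance between distinct vertices is 1, and W = WW = C(m-1, 2).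

module Submission where

open import Defs
open import Data.Nat using (ℕ; _^_; _<_; _∸_)
open import Data.Nat.Primality using (Prime)
open import Data.Nat.Combinatorics using (_C_)
open import Data.Fin.Subset using (Subset)
open import Data.Product using (_×_; ∃-syntax)
open import Relation.Binary.PropositionalEquality using (_≡_)

open import Data.Bool using (true; false)
open import Data.Bool.Properties using (T-≡)
open import Data.Empty using (⊥-elim)
open import Data.Fin using (Fin; toℕ)
open import Data.Fin.Properties using (toℕ-fromℕ<; toℕ-injective; toℕ<n; ¬∀⟶∃¬)
open import Data.Fin.Subset using (_∈_; _∉_; _⊆_; ⊤)
open import Data.Fin.Subset.Properties using (_∈?_; _⊆?_; ⊆-antisym; ⊆⊤; x∈⁅x⁆; x∈⁅y⁆⇒x≡y)
open import Data.List using (List; []; _∷_; map; _++_; length; applyUpTo)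
open import Data.List.Membership.Propositional using () renaming (_∈_ to _∈ₗ_)
open import Data.List.Membership.Propositional.Properties
  using (∈-map⁺; ∈-map⁻; ∈-++⁺ˡ; ∈-++⁺ʳ; ∈-++⁻; ∈-filter⁺; ∈-filter⁻; ∈-applyUpTo⁺; ∈-applyUpTo⁻)
open import Data.List.Membership.Propositional.Properties.WithK using (unique∧set⇒bag)
open import Data.List.Properties using (length-map; length-++; length-applyUpTo)
open import Data.List.Relation.Binary.BagAndSetEquality using (∼bag⇒↭)
open import Data.List.Relation.Binary.Permutation.Propositional.Properties using (↭-length)
open import Data.List.Relation.Unary.All as All using ()
open import Data.List.Relation.Unary.AllPairs as AllPairs using (_∷_)
open import Data.List.Relation.Unary.Any using (here; there)
open import Data.List.Relation.Unary.Unique.Propositional using (Unique)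
import Data.List.Relation.Unary.Unique.Propositional.Properties as Unique
open import Data.Nat using (suc; zero; _+_; _*_; _≤_; pred; NonZero; z≤n; s≤s; s≤s⁻¹; s<s; z<s; >-nonZero⁻¹; ≢-nonZero⁻¹; nonTrivial⇒n>1; _%_; _/_)
open import Data.Nat.Combinatorics using (nC1≡n; nCk+nC[k+1]≡[n+1]C[k+1])
open import Data.Nat.Coprimality using (Coprime; coprime-divisor; coprime⇒gcd≡1)
open import Data.Nat.Divisibility
open import Data.Nat.DivMod
open import Data.Nat.GCD using (gcd; gcd-GCD; c*gcd[m,n]≡gcd[cm,cn]; module Bézout)
open import Data.Nat.ListAction using (sum)
open import Data.Nat.Primality using (prime⇒irreducible; prime⇒nonZero; prime⇒nonTrivial)
open import Data.Nat.Properties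
open import Data.Nat.Tactic.RingSolver using (solve-∀)
open import Data.Product using (_,_; proj₂)
open import Data.Sum using (_⊎_; inj₁; inj₂)
open import Data.Vec using (tabulate; []; _∷_)
open import Data.Vec.Properties using ([]=⇒lookup; lookup⇒[]=; lookup∘tabulate; ∷-injectiveʳ)
open import Function using (_∘_)
open import Function.Bundles using (Equivalence; mk⇔)
open import Relation.Binary.PropositionalEquality using (_≢_; refl; sym; trans; cong; cong₂; subst; module ≡-Reasoning)
open import Relation.Nullary using (¬_; yes; no)
open import Relation.Nullary.Decidable using (isYes; toWitness; fromWitness; _→-dec_)
open import Relation.Unary using (Decidable)

length-pairs : ∀ {A : Set} (xs : List A) → length (pairs xs) ≡ length xs C 2
length-pairs [] = refl
length-pairs (x ∷ xs) = begin
  length (map (x ,_) xs ++ pairs xs)          ≡⟨ length-++ (map (x ,_) xs) ⟩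
  length (map (x ,_) xs) + length (pairs xs)  ≡⟨ cong₂ _+_ (length-map (x ,_) xs) (length-pairs xs) ⟩
  length xs + length xs C 2                   ≡⟨ cong (_+ length xs C 2) (nC1≡n (length xs)) ⟨
  length xs C 1 + length xs C 2               ≡⟨ nCk+nC[k+1]≡[n+1]C[k+1] (length xs) 1 ⟩
  suc (length xs) C 2                         ∎
  where open ≡-Reasoning

∈-pairs⁻ : ∀ {A : Set} {xs : List A} → Unique xs → ∀ {u v} → (u , v) ∈ₗ pairs xs →
  u ≢ v × u ∈ₗ xs × v ∈ₗ xs
∈-pairs⁻ {xs = x ∷ xs} (x∉xs ∷ unique) uv∈ with ∈-++⁻ (map (x ,_) xs) uv∈
... | inj₁ uv∈head with ∈-map⁻ (x ,_) uv∈head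
...   | v , v∈xs , refl = All.lookup x∉xs v∈xs , here refl , there v∈xs
∈-pairs⁻ {xs = x ∷ xs} (_ ∷ unique) uv∈ | inj₂ uv∈tail with ∈-pairs⁻ unique uv∈tail
... | u≢v , u∈xs , v∈xs = u≢v , there u∈xs , there v∈xs

sum-map-const : ∀ {A : Set} (f : A → ℕ) c (xs : List A) → (∀ x → x ∈ₗ xs → f x ≡ c) →
  sum (map f xs) ≡ c * length xs
sum-map-const f c [] _ = sym (*-zeroʳ c)
sum-map-const f c (x ∷ xs) f≡c = begin
  f x + sum (map f xs)  ≡⟨ cong₂ _+_ (f≡c x (here refl)) (sum-map-const f c xs (λ y → f≡c y ∘ there)) ⟩
  c + c * length xs     ≡⟨ *-suc c (length xs) ⟨
  c * suc (length xs)   ∎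
  where open ≡-Reasoning

allSubsets-complete : ∀ k (s : Subset k) → s ∈ₗ allSubsets k
allSubsets-complete zero [] = here refl
allSubsets-complete (suc k) (true ∷ s) = ∈-++⁺ˡ (∈-map⁺ (true ∷_) (allSubsets-complete k s))
allSubsets-complete (suc k) (false ∷ s) =
  ∈-++⁺ʳ (map (true ∷_) (allSubsets k)) (∈-map⁺ (false ∷_) (allSubsets-complete k s))

allSubsets-unique : ∀ k → Unique (allSubsets k)
allSubsets-unique zero = All.[] ∷ AllPairs.[]
allSubsets-unique (suc k) = Unique.++⁺ (Unique.map⁺ ∷-injectiveʳ (allSubsets-unique k))
                                       (Unique.map⁺ ∷-injectiveʳ (allSubsets-unique k)) disjoint
  where
  disjoint : ∀ {s} → ¬ (s ∈ₗ map (true ∷_) (allSubsets k) × s ∈ₗ map (false ∷_) (allSubsets k))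
  disjoint (s∈true , s∈false) with ∈-map⁻ (true ∷_) s∈true | ∈-map⁻ (false ∷_) s∈false
  ... | _ , _ , refl | _ , _ , ()

⊈⇒∃∉ : ∀ {n} {I J : Subset n} → ¬ I ⊆ J → ∃[ x ] x ∈ I × x ∉ J
⊈⇒∃∉ {n} {I} {J} I⊈J with ¬∀⟶∃¬ n (λ x → x ∈ I → x ∈ J) (λ x → x ∈? I →-dec x ∈? J) (λ I⊆J → I⊈J (I⊆J _))
... | x , x∈I⇏x∈J with x ∈? I
...   | yes x∈I = x , x∈I , λ x∈J → x∈I⇏x∈J (λ _ → x∈J)
...   | no x∉I = ⊥-elim (x∈I⇏x∈J (⊥-elim ∘ x∉I))

threshold : ∀ {P : ℕ → Set} → Decidable P → P 0 → ∀ n →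
  ∃[ k ] k ≤ n × P k × (k ≡ n ⊎ ¬ P (suc k))
threshold P? P0 zero = 0 , z≤n , P0 , inj₁ refl
threshold P? P0 (suc n) with threshold P? P0 n
... | k , k≤n , Pk , inj₂ ¬Pk+1 = k , m≤n⇒m≤1+n k≤n , Pk , inj₂ ¬Pk+1
... | k , k≤n , Pk , inj₁ refl with P? (suc n)
...   | yes Pn+1 = suc n , ≤-refl , Pn+1 , inj₁ refl
...   | no ¬Pn+1 = n , n≤1+n n , Pk , inj₂ ¬Pn+1

[m*[n%o]]%o≡[m*n]%o : ∀ m n o .{{_ : NonZero o}} → (m * (n % o)) % o ≡ (m * n) % o
[m*[n%o]]%o≡[m*n]%o m n o = begin
  (m * (n % o)) % o            ≡⟨ %-distribˡ-* m (n % o) o ⟩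
  ((m % o) * (n % o % o)) % o  ≡⟨ cong (λ k → ((m % o) * k) % o) (m%n%n≡m%n n o) ⟩
  ((m % o) * (n % o)) % o      ≡⟨ %-distribˡ-* m n o ⟨
  (m * n) % o                  ∎
  where open ≡-Reasoning

gcd-residue : ∀ a N .{{_ : NonZero N}} → ∃[ c ] (c * a) % N ≡ gcd a N % N
gcd-residue a N@(suc n) with Bézout.identity (gcd-GCD a N)
... | Bézout.+- x y g+yN≡xa = x , (begin
  (x * a) % N              ≡⟨ cong (_% N) g+yN≡xa ⟨
  (gcd a N + y * N) % N    ≡⟨ [m+kn]%n≡m%n (gcd a N) y N ⟩
  gcd a N % N              ∎)
  where open ≡-Reasoning
-- Modulo N this case reads g ≡ - x a, and - 1 ≡ N - 1 = n.
... | Bézout.-+ x y g+xa≡yN = x * n , (begin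
  (x * n * a) % N                  ≡⟨ [m+kn]%n≡m%n (x * n * a) y N ⟨
  (x * n * a + y * N) % N          ≡⟨ cong (λ k → (x * n * a + k) % N) g+xa≡yN ⟨
  (x * n * a + (g + x * a)) % N    ≡⟨ cong (_% N) (regroup x n a g) ⟩
  (g + (x * a) * N) % N            ≡⟨ [m+kn]%n≡m%n g (x * a) N ⟩
  g % N                            ∎)
  where
  open ≡-Reasoning
  g = gcd a N
  regroup : ∀ x n a g → x * n * a + (g + x * a) ≡ g + (x * a) * suc n
  regroup = solve-∀

coprime-^ : ∀ {p u} → Prime p → ¬ p ∣ u → ∀ e → Coprime u (p ^ e)
coprime-^ pr p∤u zero (_ , d∣1) = ∣1⇒≡1 d∣1
coprime-^ {p} pr p∤u (suc e) {d} (d∣u , d∣p*pᵉ) =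
  coprime-^ pr p∤u e (d∣u , coprime-divisor coprime[d,p] d∣p*pᵉ)
  where
  coprime[d,p] : Coprime d p
  coprime[d,p] (c∣d , c∣p) with prime⇒irreducible pr c∣p
  ... | inj₁ c≡1 = c≡1
  ... | inj₂ refl = ⊥-elim (p∤u (∣-trans c∣d d∣u))

^-monoʳ-∣ : ∀ p {i j} → i ≤ j → p ^ i ∣ p ^ j
^-monoʳ-∣ p {i} {j} i≤j = divides (p ^ (j ∸ i)) (begin
  p ^ j                ≡⟨ cong (p ^_) (m+[n∸m]≡n i≤j) ⟨
  p ^ (i + (j ∸ i))    ≡⟨ ^-distribˡ-+-* p i (j ∸ i) ⟩
  p ^ i * p ^ (j ∸ i)  ≡⟨ *-comm (p ^ i) (p ^ (j ∸ i)) ⟩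
  p ^ (j ∸ i) * p ^ i  ∎)
  where open ≡-Reasoning

gcd[pᵏ*u,pᵐ]≡pᵏ : ∀ {p u k m} → Prime p → ¬ p ∣ u → k ≤ m → gcd (p ^ k * u) (p ^ m) ≡ p ^ k
gcd[pᵏ*u,pᵐ]≡pᵏ {p} {u} {k} {m} pr p∤u k≤m = begin
  gcd (p ^ k * u) (p ^ m)                ≡⟨ cong (gcd (p ^ k * u) ∘ (p ^_)) (m+[n∸m]≡n k≤m) ⟨
  gcd (p ^ k * u) (p ^ (k + (m ∸ k)))    ≡⟨ cong (gcd (p ^ k * u)) (^-distribˡ-+-* p k (m ∸ k)) ⟩
  gcd (p ^ k * u) (p ^ k * p ^ (m ∸ k))  ≡⟨ c*gcd[m,n]≡gcd[cm,cn] (p ^ k) u (p ^ (m ∸ k)) ⟨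
  p ^ k * gcd u (p ^ (m ∸ k))            ≡⟨ cong (p ^ k *_) (coprime⇒gcd≡1 (coprime-^ pr p∤u (m ∸ k))) ⟩
  p ^ k * 1                              ≡⟨ *-identityʳ (p ^ k) ⟩
  p ^ k                                  ∎
  where open ≡-Reasoning

module ZModProperties (n : ℕ) {{nz : NonZero n}} where
  open ZMod n

  toℕ-fromℕ : ∀ a → toℕ (fromℕ a) ≡ a % n
  toℕ-fromℕ a = toℕ-fromℕ< (m%n<n a n)

  toℕ-fromℕ-< : ∀ {a} → a < n → toℕ (fromℕ a) ≡ a
  toℕ-fromℕ-< {a} a<n = trans (toℕ-fromℕ a) (m<n⇒m%n≡m a<n)

  fromℕ-toℕ : ∀ x → fromℕ (toℕ x) ≡ x
  fromℕ-toℕ x = toℕ-injective (toℕ-fromℕ-< (toℕ<n x))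

  toℕ-0# : toℕ 0# ≡ 0
  toℕ-0# = toℕ-fromℕ-< (>-nonZero⁻¹ n)

  x⊕0#≡x : ∀ x → x ⊕ 0# ≡ x
  x⊕0#≡x x = trans (cong (λ k → fromℕ (toℕ x + k)) toℕ-0#)
                   (trans (cong fromℕ (+-identityʳ (toℕ x))) (fromℕ-toℕ x))

  fromℕ-⊗ : ∀ c x → fromℕ c ⊗ x ≡ fromℕ (c * toℕ x)
  fromℕ-⊗ c x = toℕ-injective (begin
    toℕ (fromℕ c ⊗ x)            ≡⟨ toℕ-fromℕ _ ⟩
    (toℕ (fromℕ c) * toℕ x) % n  ≡⟨ cong (λ k → (k * toℕ x) % n) (toℕ-fromℕ c) ⟩
    ((c % n) * toℕ x) % n        ≡⟨ cong (_% n) (*-comm (c % n) (toℕ x)) ⟩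
    (toℕ x * (c % n)) % n        ≡⟨ [m*[n%o]]%o≡[m*n]%o (toℕ x) c n ⟩
    (toℕ x * c) % n              ≡⟨ cong (_% n) (*-comm (toℕ x) c) ⟩
    (c * toℕ x) % n              ≡⟨ toℕ-fromℕ _ ⟨
    toℕ (fromℕ (c * toℕ x))      ∎)
    where open ≡-Reasoning

  multiples : ℕ → Subset n
  multiples d = tabulate (λ x → isYes (d ∣? toℕ x))

  ∈-multiples⁻ : ∀ {d x} → x ∈ multiples d → d ∣ toℕ x
  ∈-multiples⁻ {d} {x} x∈ = toWitness (Equivalence.from T-≡
    (trans (sym (lookup∘tabulate _ x)) ([]=⇒lookup x∈)))

  ∈-multiples⁺ : ∀ {d x} → d ∣ toℕ x → x ∈ multiples d
  ∈-multiples⁺ {d} {x} d∣x = lookup⇒[]= x (multiples d)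
    (trans (lookup∘tabulate _ x) (Equivalence.to T-≡ (fromWitness d∣x)))

  fromℕ-∈-multiples : ∀ {d a} → d ∣ n → d ∣ a → fromℕ a ∈ multiples d
  fromℕ-∈-multiples {d} {a} d∣n d∣a =
    ∈-multiples⁺ (subst (d ∣_) (sym (toℕ-fromℕ a)) (%-presˡ-∣ d∣a d∣n))

  multiples-isIdeal : ∀ {d} → d ∣ n → IsIdeal (multiples d)
  multiples-isIdeal {d} d∣n =
      fromℕ-∈-multiples d∣n (d ∣0)
    , (λ a b a∈ b∈ → fromℕ-∈-multiples d∣n (∣m∣n⇒∣m+n (∈-multiples⁻ a∈) (∈-multiples⁻ b∈)))
    , (λ a a∈ → fromℕ-∈-multiples d∣n (∣m+n∣m⇒∣n
          (subst (d ∣_) (sym (m+[n∸m]≡n (<⇒≤ (toℕ<n a)))) d∣n) (∈-multiples⁻ a∈)))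
    , (λ r a a∈ → fromℕ-∈-multiples d∣n (∣n⇒∣m*n (toℕ r) (∈-multiples⁻ a∈)))

  gcd∣⇒∈ideal : ∀ {I x y} → IsIdeal I → x ∈ I → gcd (toℕ x) n ∣ toℕ y → y ∈ I
  gcd∣⇒∈ideal {I} {x} {y} (_ , _ , _ , ⊗-closed) x∈I (divides t y≡t*g)
    with gcd-residue (toℕ x) n
  ... | c , cx≡g = subst (_∈ I) y≡ (⊗-closed (fromℕ (t * c)) x x∈I)
    where
    open ≡-Reasoning
    g = gcd (toℕ x) n
    y≡ : fromℕ (t * c) ⊗ x ≡ y
    y≡ = toℕ-injective (begin
      toℕ (fromℕ (t * c) ⊗ x)      ≡⟨ cong toℕ (fromℕ-⊗ (t * c) x) ⟩
      toℕ (fromℕ (t * c * toℕ x))  ≡⟨ toℕ-fromℕ _ ⟩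
      (t * c * toℕ x) % n          ≡⟨ cong (_% n) (*-assoc t c (toℕ x)) ⟩
      (t * (c * toℕ x)) % n        ≡⟨ [m*[n%o]]%o≡[m*n]%o t (c * toℕ x) n ⟨
      (t * ((c * toℕ x) % n)) % n  ≡⟨ cong (λ k → (t * k) % n) cx≡g ⟩
      (t * (g % n)) % n            ≡⟨ [m*[n%o]]%o≡[m*n]%o t g n ⟩
      (t * g) % n                  ≡⟨ cong (_% n) y≡t*g ⟨
      toℕ y % n                    ≡⟨ m<n⇒m%n≡m (toℕ<n y) ⟩
      toℕ y                        ∎)

  common⇒sumEssential : ∀ s → s ≢ 0# → (∀ J → IsIdeal J → J ≢ zeroIdeal → s ∈ J) →
    ∀ {I K} → IsIdeal I → I ≢ zeroIdeal → IsIdeal K → SumEssential I K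
  common⇒sumEssential s s≢0 common isI I≢0 (0∈K , _) J isJ J≢0 =
    s , s≢0 , (s , 0# , common _ isI I≢0 , 0∈K , sym (x⊕0#≡x s)) , common J isJ J≢0

  multiples-1 : multiples 1 ≡ ⊤
  multiples-1 = ⊆-antisym ⊆⊤ (λ {x} _ → ∈-multiples⁺ (1∣ toℕ x))

  multiples-n⊆zeroIdeal : multiples n ⊆ zeroIdeal
  multiples-n⊆zeroIdeal {x} x∈ = subst (_∈ zeroIdeal) (sym x≡0#) (x∈⁅x⁆ 0#)
    where
    x≡0# : x ≡ 0#
    x≡0# = toℕ-injective (begin
      toℕ x      ≡⟨ m<n⇒m%n≡m (toℕ<n x) ⟨
      toℕ x % n  ≡⟨ n∣m⇒m%n≡0 (toℕ x) n (∈-multiples⁻ x∈) ⟩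
      0          ≡⟨ toℕ-0# ⟨
      toℕ 0#     ∎)
      where open ≡-Reasoning

  ideal⊆zeroIdeal⇒≡ : ∀ {I} → IsIdeal I → I ⊆ zeroIdeal → I ≡ zeroIdeal
  ideal⊆zeroIdeal⇒≡ {I} (0∈I , _) I⊆0 =
    ⊆-antisym I⊆0 (λ x∈ → subst (_∈ I) (sym (x∈⁅y⁆⇒x≡y 0# x∈)) 0∈I)

module EssentialGraphProperties (n : ℕ) {{nz : NonZero n}} where
  open EssentialGraph n

  ∈-vertices⁻ : ∀ {u} → u ∈ₗ vertices → IsVertex u
  ∈-vertices⁻ = proj₂ ∘ ∈-filter⁻ isVertex? {xs = allSubsets n}

  ∈-vertices⁺ : ∀ {u} → IsVertex u → u ∈ₗ vertices
  ∈-vertices⁺ {u} = ∈-filter⁺ isVertex? (allSubsets-complete n u)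

  vertices-unique : Unique vertices
  vertices-unique = Unique.filter⁺ isVertex? (allSubsets-unique n)

  isDist-adjacent : ∀ {u v k} → u ≢ v → Walk u v 1 → IsDist u v k → k ≡ 1
  isDist-adjacent {k = zero} u≢v _ (here , _) = ⊥-elim (u≢v refl)
  isDist-adjacent {k = suc k} _ walk (_ , shortest) = cong suc (n≤0⇒n≡0 (s≤s⁻¹ (shortest 1 walk)))

  module Complete (complete : ∀ {u v} → IsVertex u → IsVertex v → SumEssential u v) where

    walk-distinct : ∀ {u v} → IsVertex u → IsVertex v → u ≢ v → Walk u v 1
    walk-distinct isU isV u≢v = step isV (u≢v , complete isU isV) here

    distance-exists : ∀ u v → IsVertex u → IsVertex v → ∃[ k ] IsDist u v k
    distance-exists u v isU isV with u ≟S v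
    ... | yes refl = 0 , here , λ _ _ → z≤n
    ... | no u≢v = 1 , walk-distinct isU isV u≢v , shortest
      where
      shortest : ∀ j → Walk u v j → 1 ≤ j
      shortest zero here = ⊥-elim (u≢v refl)
      shortest (suc j) _ = s≤s z≤n

    module _ (d : Subset n → Subset n → ℕ)
             (isDist : ∀ u v → IsVertex u → IsVertex v → IsDist u v (d u v)) where

      distance-pairs : ∀ u v → (u , v) ∈ₗ pairs vertices → d u v ≡ 1
      distance-pairs u v uv∈ with ∈-pairs⁻ vertices-unique uv∈
      ... | u≢v , u∈ , v∈ = isDist-adjacent u≢v (walk-distinct isU isV u≢v) (isDist u v isU isV)
        where
        isU = ∈-vertices⁻ u∈
        isV = ∈-vertices⁻ v∈

      wiener-complete : wiener d ≡ length vertices C 2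
      wiener-complete = begin
        wiener d                     ≡⟨ sum-map-const _ 1 (pairs vertices) (λ { (u , v) → distance-pairs u v }) ⟩
        1 * length (pairs vertices)  ≡⟨ *-identityˡ _ ⟩
        length (pairs vertices)      ≡⟨ length-pairs vertices ⟩
        length vertices C 2          ∎
        where open ≡-Reasoning

      hyperWiener-complete : hyperWiener d ≡ length vertices C 2
      hyperWiener-complete = begin
        hyperWiener d                     ≡⟨ cong (_/ 2) (sum-map-const _ 2 (pairs vertices)
                                              (λ { (u , v) uv∈ → cong (λ k → k + k * k) (distance-pairs u v uv∈) })) ⟩
        2 * length (pairs vertices) / 2   ≡⟨ cong (_/ 2) (*-comm 2 (length (pairs vertices))) ⟩
        length (pairs vertices) * 2 / 2   ≡⟨ m*n/n≡m (length (pairs vertices)) 2 ⟩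
        length (pairs vertices)           ≡⟨ length-pairs vertices ⟩
        length vertices C 2               ∎
        where open ≡-Reasoning

module PrimePower (p m : ℕ) (pr : Prime p) .{{_ : NonZero m}} where
  instance
    pᵐ≢0 : NonZero (p ^ m)
    pᵐ≢0 = primePowNonZero p m pr
    p≢0 : NonZero p
    p≢0 = prime⇒nonZero pr

  open EssentialGraph (p ^ m)
  open ZModProperties (p ^ m)
  open EssentialGraphProperties (p ^ m)

  1<p : 1 < p
  1<p = nonTrivial⇒n>1 p {{prime⇒nonTrivial pr}}

  powerIdeal : ℕ → Subset (p ^ m)
  powerIdeal i = multiples (p ^ i)

  powerIdeal-isIdeal : ∀ {i} → i ≤ m → IsIdeal (powerIdeal i)
  powerIdeal-isIdeal i≤m = multiples-isIdeal (^-monoʳ-∣ p i≤m)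

  powerIdeal-m : powerIdeal m ≡ zeroIdeal
  powerIdeal-m = ideal⊆zeroIdeal⇒≡ (powerIdeal-isIdeal ≤-refl) multiples-n⊆zeroIdeal

  toℕ-fromℕ-pⁱ : ∀ {i} → i < m → toℕ (fromℕ (p ^ i)) ≡ p ^ i
  toℕ-fromℕ-pⁱ i<m = toℕ-fromℕ-< (^-monoʳ-< p 1<p i<m)

  pʲ∈powerIdeal : ∀ {i j} → i ≤ j → j ≤ m → fromℕ (p ^ j) ∈ powerIdeal i
  pʲ∈powerIdeal i≤j j≤m = fromℕ-∈-multiples (^-monoʳ-∣ p (≤-trans i≤j j≤m)) (^-monoʳ-∣ p i≤j)

  powerIdeal-strict : ∀ {i j} → i < j → j ≤ m → powerIdeal i ≢ powerIdeal j
  powerIdeal-strict {i} {j} i<j j≤m eq = <⇒≱ (^-monoʳ-< p 1<p i<j) (∣⇒≤ {{m^n≢0 p i}} pʲ∣pⁱ)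
    where
    i<m = <-≤-trans i<j j≤m
    pʲ∣pⁱ : p ^ j ∣ p ^ i
    pʲ∣pⁱ = subst (p ^ j ∣_) (toℕ-fromℕ-pⁱ i<m)
      (∈-multiples⁻ (subst (fromℕ (p ^ i) ∈_) eq (pʲ∈powerIdeal ≤-refl (<⇒≤ i<m))))

  powerIdeal-isVertex : ∀ {i} → 0 < i → i < m → IsVertex (powerIdeal i)
  powerIdeal-isVertex 0<i i<m =
      powerIdeal-isIdeal (<⇒≤ i<m)
    , (λ eq → powerIdeal-strict i<m ≤-refl (trans eq (sym powerIdeal-m)))
    , (λ eq → powerIdeal-strict 0<i (<⇒≤ i<m) (trans multiples-1 (sym eq)))

  powerIdeal⊆ideal : ∀ {I x k} → IsIdeal I → x ∈ I → x ∈ powerIdeal k → x ∉ powerIdeal (suc k) →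
    k ≤ m → powerIdeal k ⊆ I
  powerIdeal⊆ideal {I} {x} {k} isI x∈I x∈pᵏ x∉pᵏ⁺¹ k≤m y∈pᵏ with ∈-multiples⁻ x∈pᵏ
  ... | divides u x≡u*pᵏ = gcd∣⇒∈ideal isI x∈I (subst (_∣ _) (sym gcd≡pᵏ) (∈-multiples⁻ y∈pᵏ))
    where
    p∤u : ¬ p ∣ u
    p∤u p∣u = x∉pᵏ⁺¹ (∈-multiples⁺ (subst (p ^ suc k ∣_) (sym x≡u*pᵏ) (*-monoˡ-∣ (p ^ k) p∣u)))
    gcd≡pᵏ : gcd (toℕ x) (p ^ m) ≡ p ^ k
    gcd≡pᵏ = trans (cong (λ a → gcd a (p ^ m)) (trans x≡u*pᵏ (*-comm u (p ^ k))))
                   (gcd[pᵏ*u,pᵐ]≡pᵏ pr p∤u k≤m)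

  nonzeroIdeal⊈powerIdeal-m : ∀ {I} → IsIdeal I → I ≢ zeroIdeal → ¬ I ⊆ powerIdeal m
  nonzeroIdeal⊈powerIdeal-m {I} isI I≢0 I⊆pᵐ =
    I≢0 (ideal⊆zeroIdeal⇒≡ isI (subst (I ⊆_) powerIdeal-m I⊆pᵐ))

  -- k is the largest exponent with I ⊆ (p^k); an element of I outside (p^(k+1)) generates (p^k).
  classification : ∀ {I} → IsIdeal I → I ≢ zeroIdeal → ∃[ i ] i < m × I ≡ powerIdeal i
  classification {I} isI I≢0 with threshold (λ k → I ⊆? powerIdeal k) (λ {x} _ → ∈-multiples⁺ (1∣ toℕ x)) m
  ... | _ , _ , I⊆pᵐ , inj₁ refl = ⊥-elim (nonzeroIdeal⊈powerIdeal-m isI I≢0 I⊆pᵐ)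
  ... | k , k≤m , I⊆pᵏ , inj₂ I⊈pᵏ⁺¹ with ⊈⇒∃∉ I⊈pᵏ⁺¹
  ...   | x , x∈I , x∉pᵏ⁺¹ =
    k , ≤∧≢⇒< k≤m (λ { refl → nonzeroIdeal⊈powerIdeal-m isI I≢0 I⊆pᵏ }) ,
    ⊆-antisym I⊆pᵏ (powerIdeal⊆ideal isI x∈I (I⊆pᵏ x∈I) x∉pᵏ⁺¹ k≤m)

  pred[m]<m : pred m < m
  pred[m]<m = m≤pred[n]⇒suc[m]≤n ≤-refl

  pᵐ⁻¹ : Fin (p ^ m)
  pᵐ⁻¹ = fromℕ (p ^ pred m)

  pᵐ⁻¹≢0# : pᵐ⁻¹ ≢ 0#
  pᵐ⁻¹≢0# pᵐ⁻¹≡0# = ≢-nonZero⁻¹ (p ^ pred m) {{m^n≢0 p (pred m)}} (begin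
    p ^ pred m  ≡⟨ toℕ-fromℕ-pⁱ pred[m]<m ⟨
    toℕ pᵐ⁻¹    ≡⟨ cong toℕ pᵐ⁻¹≡0# ⟩
    toℕ 0#      ≡⟨ toℕ-0# ⟩
    0           ∎)
    where open ≡-Reasoning

  pᵐ⁻¹∈nonzeroIdeal : ∀ J → IsIdeal J → J ≢ zeroIdeal → pᵐ⁻¹ ∈ J
  pᵐ⁻¹∈nonzeroIdeal J isJ J≢0 with classification isJ J≢0
  ... | i , i<m , refl = pʲ∈powerIdeal (<⇒≤pred i<m) (<⇒≤ pred[m]<m)

  complete : ∀ {u v} → IsVertex u → IsVertex v → SumEssential u v
  complete (isU , u≢0 , _) (isV , _) =
    common⇒sumEssential pᵐ⁻¹ pᵐ⁻¹≢0# pᵐ⁻¹∈nonzeroIdeal isU u≢0 isV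

  nonunitPowerIdeals : List (Subset (p ^ m))
  nonunitPowerIdeals = applyUpTo (powerIdeal ∘ suc) (pred m)

  ∈-vertices⇒∈-nonunitPowerIdeals : ∀ {u} → u ∈ₗ vertices → u ∈ₗ nonunitPowerIdeals
  ∈-vertices⇒∈-nonunitPowerIdeals u∈ with ∈-vertices⁻ u∈
  ... | isU , u≢0 , u≢⊤ with classification isU u≢0
  ...   | zero , _ , refl = ⊥-elim (u≢⊤ multiples-1)
  ...   | suc i , i<m , refl = ∈-applyUpTo⁺ (powerIdeal ∘ suc) (suc[m]≤n⇒m≤pred[n] i<m)

  ∈-nonunitPowerIdeals⇒∈-vertices : ∀ {u} → u ∈ₗ nonunitPowerIdeals → u ∈ₗ vertices
  ∈-nonunitPowerIdeals⇒∈-vertices u∈ with ∈-applyUpTo⁻ (powerIdeal ∘ suc) u∈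
  ... | i , i<pred[m] , refl = ∈-vertices⁺ (powerIdeal-isVertex z<s (m≤pred[n]⇒suc[m]≤n i<pred[m]))

  nonunitPowerIdeals-unique : Unique nonunitPowerIdeals
  nonunitPowerIdeals-unique = Unique.applyUpTo⁺₁ (powerIdeal ∘ suc) (pred m)
    (λ i<j j<pred[m] → powerIdeal-strict (s<s i<j) (<⇒≤ (m≤pred[n]⇒suc[m]≤n j<pred[m])))

  length-vertices : length vertices ≡ pred m
  length-vertices = begin
    length vertices             ≡⟨ ↭-length (∼bag⇒↭ (unique∧set⇒bag vertices-unique nonunitPowerIdeals-unique
                                     (mk⇔ ∈-vertices⇒∈-nonunitPowerIdeals ∈-nonunitPowerIdeals⇒∈-vertices))) ⟩
    length nonunitPowerIdeals   ≡⟨ length-applyUpTo (powerIdeal ∘ suc) (pred m) ⟩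
    pred m                      ∎
    where open ≡-Reasoning

mainTheorem12 : ∀ (p m : ℕ) (pr : Prime p) → 1 < m →
    let open EssentialGraph (p ^ m) {{primePowNonZero p m pr}} in
    ((u v : Subset (p ^ m)) → IsVertex u → IsVertex v → ∃[ k ] IsDist u v k)
    × ((d : Subset (p ^ m) → Subset (p ^ m) → ℕ) →
       ((u v : Subset (p ^ m)) → IsVertex u → IsVertex v → IsDist u v (d u v)) →
       (wiener d ≡ (m ∸ 1) C 2) × (hyperWiener d ≡ (m ∸ 1) C 2))
mainTheorem12 p zero pr ()
mainTheorem12 p m@(suc _) pr _ =
  distance-exists , λ d isDist →
    trans (wiener-complete d isDist) pairs-count , trans (hyperWiener-complete d isDist) pairs-count
  where
  open PrimePower p m pr
  open EssentialGraph (p ^ m)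
  open EssentialGraphProperties.Complete (p ^ m) complete
  pairs-count : length vertices C 2 ≡ (m ∸ 1) C 2
  pairs-count = cong (_C 2) length-vertices
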